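{- Let $\mathcal{L}$ be a fragment as in the context with $\exists\notin\mathcal{O}$, no action constructors, and $\{\Diamond,@,\downarrow\}\subseteq\mathcal{O}$. Let $\mathfrak{M},\mathfrak{N}$ be $\Delta$-models and $B$ an $\omega$-bisimulation from $\mathfrak{M}$ to $\mathfrak{N}$ with $(\overline{w},w)\mathrel{B_\ell}(\overline{v},v)$. Then the map $h$ defined by $h(\overline{w}(i))=\overline{v}(i)$ for $i\in\{1,\dots,\ell\}$ is a well-defined partial isomorphism from $\mathfrak{M}$ to $\mathfrak{N}$: a bijection from $\{\overline{w}(1),\dots,\overline{w}(\ell)\}$ onto $\{\overline{v}(1),\dots,\overline{v}(\ell)\}$ such that $(\mathfrak{M},u)$ and $(\mathfrak{N},h(u))$ satisfy the same basic sentences for all $u$ in its domain, and $u_1\mathrel{\lambda^{\mathfrak{M}}}u_2$ iff $h(u_1)\mathrel{\lambda^{\mathfrak{N}}}h(u_2)$ for all $\lambda\in P$ and $u_1,u_2$ in its domain.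
   Context: Hybrid-dynamic propositional logic (HDPL). A signature is $\Delta=((F,P),\mathtt{Prop})$ with $F$ nominals, $P$ binary relation symbols, $\mathtt{Prop}$ propositional symbols. A $\Delta$-model $\mathfrak{M}$: a nonempty set $|\mathfrak{M}|$ of states, states $k^{\mathfrak{M}}$ ($k\in F$), relations $\lambda^{\mathfrak{M}}$ ($\lambda\in P$), $M(w)\subseteq\mathtt{Prop}$ per state. Basic sentences $F\cup\mathtt{Prop}$: $k$ holds at $w$ iff $w=k^{\mathfrak{M}}$, $p$ iff $p\in M(w)$. $\mathcal{L}$ is a fragment of HDPL obtained by discarding some action constructors and/or some of the sentence constructors $\Diamond$ (possibility over actions), $@$ (retrieve), $\downarrow$ (store), $\exists$; $\mathcal{O}$ is the set retained, $\mathcal{A}(\Delta)$ the $\mathcal{L}$-actions (here just the relation symbols $\lambda\in P$, with $\lambda^{\mathfrak{M}}(w)=\{w'\mid(w,w')\in\lambda^{\mathfrak{M}}\}$). $\omega$-bisimulation: a relation $B_\ell\subseteq(|\mathfrak{M}|^\ell\times|\mathfrak{M}|)\times(|\mathfrak{N}|^\ell\times|\mathfrak{N}|)$ is an $\ell$-bisimulation if for all $(\overline{w},w)\mathrel{B_\ell}(\overline{v},v)$: (prop) $p\in M(w)$ iff $p\in N(v)$; (nom) $w=k^{\mathfrak{M}}$ iff $v=k^{\mathfrak{N}}$; (wvar) $\overline{w}(j)=w$ iff $\overline{v}(j)=v$ ($1\le j\le\ell$, $\overline{w}(j)$ the $j$-th entry); (forth) if $\Diamond\in\mathcal{O}$,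 for all $\mathfrak{a}\in\mathcal{A}(\Delta)$, $w'\in\mathfrak{a}^{\mathfrak{M}}(w)$ there is $v'\in\mathfrak{a}^{\mathfrak{N}}(v)$ with $(\overline{w},w')\mathrel{B_\ell}(\overline{v},v')$; (back) symmetric; (atv) if $@\in\mathcal{O}$, $(\overline{w},\overline{w}(j))\mathrel{B_\ell}(\overline{v},\overline{v}(j))$ for $1\le j\le\ell$; (atn) if $@\in\mathcal{O}$, $(\overline{w},k^{\mathfrak{M}})\mathrel{B_\ell}(\overline{v},k^{\mathfrak{N}})$ for all $k\in F$. An $\omega$-bisimulation is a family $(B_\ell)_{\ell\in\omega}$ of $\ell$-bisimulations such that whenever $(\overline{w},w)\mathrel{B_\ell}(\overline{v},v)$: (st) if $\downarrow\in\mathcal{O}$, $(\overline{w}\,w,w)\mathrel{B_{\ell+1}}(\overline{v}\,v,v)$; (ex) if $\exists\in\mathcal{O}$, for all $w'$ some $v'$ has $(\overline{w}\,w',w)\mathrel{B_{\ell+1}}(\overline{v}\,v',v)$ and vice versa. -}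

module Defs where

open import Data.Bool using (Bool; true; false)
open import Data.Nat using (ℕ; suc)
open import Data.Fin using (Fin)
open import Data.Vec using (Vec; lookup; _∷ʳ_)
open import Data.Product using (Σ; _×_)
open import Data.Sum using (_⊎_)
open import Data.Unit using (⊤)
open import Relation.Binary.PropositionalEquality using (_≡_)
open import Function.Bundles using (_⇔_)

record Signature : Set₁ where
  field
    Nom  : Set
    Rel  : Set
    Prop : Set

record Model (Δ : Signature) : Set₁ where
  open Signature Δ
  field
    State     : Set
    someState : State
    nom       : Nom → State
    rel       : Rel → State → State → Set
    val       : State → Prop → Set

Basic : Signature → Set
Basic Δ = Signature.Nom Δ ⊎ Signature.Prop Δ

_,_⊨b_ : {Δ : Signature} (𝔐 : Model Δ) → Model.State 𝔐 → Basic Δ → Set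
(𝔐 , w ⊨b Data.Sum.inj₁ k) = w ≡ Model.nom 𝔐 k
(𝔐 , w ⊨b Data.Sum.inj₂ p) = Model.val 𝔐 w p

-- Fragment: which of the sentence constructors ◇, @, ↓, ∃ are retained
-- (actions are just the relation symbols; no action constructors).
record Fragment : Set where
  field
    dia   : Bool
    at    : Bool
    store : Bool
    ex    : Bool

When : Bool → Set → Set
When true  A = A
When false A = ⊤

BRel : {Δ : Signature} → Model Δ → Model Δ → ℕ → Set₁
BRel 𝔐 𝔑 ℓ = Vec (Model.State 𝔐) ℓ → Model.State 𝔐 → Vec (Model.State 𝔑) ℓ → Model.State 𝔑 → Set

record IsBisimAt {Δ : Signature} (O : Fragment) (𝔐 𝔑 : Model Δ) (ℓ : ℕ) (B : BRel 𝔐 𝔑 ℓ)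
                 (w̄ : Vec (Model.State 𝔐) ℓ) (w : Model.State 𝔐)
                 (v̄ : Vec (Model.State 𝔑) ℓ) (v : Model.State 𝔑) : Set where
  module M = Model 𝔐
  module N = Model 𝔑
  field
    prop  : ∀ p → M.val w p ⇔ N.val v p
    nomc  : ∀ k → (w ≡ M.nom k) ⇔ (v ≡ N.nom k)
    wvar  : ∀ (j : Fin ℓ) → (lookup w̄ j ≡ w) ⇔ (lookup v̄ j ≡ v)
    forth : When (Fragment.dia O)
              (∀ a w' → M.rel a w w' → Σ N.State λ v' → N.rel a v v' × B w̄ w' v̄ v')
    back  : When (Fragment.dia O)
              (∀ a v' → N.rel a v v' → Σ M.State λ w' → M.rel a w w' × B w̄ w' v̄ v')
    atv   : When (Fragment.at O) (∀ (j : Fin ℓ) → B w̄ (lookup w̄ j) v̄ (lookup v̄ j))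
    atn   : When (Fragment.at O) (∀ k → B w̄ (M.nom k) v̄ (N.nom k))

record OmegaBisim {Δ : Signature} (O : Fragment) (𝔐 𝔑 : Model Δ) : Set₁ where
  module M = Model 𝔐
  module N = Model 𝔑
  field
    B      : (ℓ : ℕ) → BRel 𝔐 𝔑 ℓ
    bisim  : ∀ ℓ w̄ w v̄ v → B ℓ w̄ w v̄ v → IsBisimAt O 𝔐 𝔑 ℓ (B ℓ) w̄ w v̄ v
    st     : ∀ ℓ w̄ w v̄ v → B ℓ w̄ w v̄ v →
               When (Fragment.store O) (B (suc ℓ) (w̄ ∷ʳ w) w (v̄ ∷ʳ v) v)
    exc    : ∀ ℓ w̄ w v̄ v → B ℓ w̄ w v̄ v →
               When (Fragment.ex O)
                 ((∀ w' → Σ N.State λ v' → B (suc ℓ) (w̄ ∷ʳ w') w (v̄ ∷ʳ v') v)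
                × (∀ v' → Σ M.State λ w' → B (suc ℓ) (w̄ ∷ʳ w') w (v̄ ∷ʳ v') v))

-- Elements of the domain are addressed through indices i : Fin ℓ; h is
-- surjective onto the image by construction.
record IsPartialIso {Δ : Signature} (𝔐 𝔑 : Model Δ) {ℓ : ℕ}
                    (w̄ : Vec (Model.State 𝔐) ℓ) (v̄ : Vec (Model.State 𝔑) ℓ) : Set where
  module M = Model 𝔐
  module N = Model 𝔑
  field
    wellDefined : ∀ (i j : Fin ℓ) → lookup w̄ i ≡ lookup w̄ j → lookup v̄ i ≡ lookup v̄ j
    injective   : ∀ (i j : Fin ℓ) → lookup v̄ i ≡ lookup v̄ j → lookup w̄ i ≡ lookup w̄ j
    basic       : ∀ (i : Fin ℓ) (φ : Basic Δ) → (𝔐 , lookup w̄ i ⊨b φ) ⇔ (𝔑 , lookup v̄ i ⊨b φ)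
    relations   : ∀ (a : Signature.Rel Δ) (i j : Fin ℓ) →
                    M.rel a (lookup w̄ i) (lookup w̄ j) ⇔ N.rel a (lookup v̄ i) (lookup v̄ j)

-- The tuples w̄ and v̄ are "remembered" by the bisimulation: by (atv) every
-- variable pair (w̄(i), v̄(i)) is again B_ℓ-related, so it agrees on basic
-- sentences, and (wvar) at that pair says w̄(j) = w̄(i) iff v̄(j) = v̄(i), which
-- gives well-definedness and injectivity of h. For the relations, (forth) moves
-- from w̄(i) along λ to w̄(j) and lands at some v' related to w̄(j); (wvar) at
-- that new pair forces v' = v̄(j), and (back) gives the converse.
module Submission where

open import Defs
open import Data.Bool using (Bool; true; false)
open import Data.Nat using (ℕ)
open import Data.Vec using (Vec; lookup)
open import Data.Sum using (inj₁; inj₂)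
open import Data.Product using (_,_)
open import Relation.Binary.PropositionalEquality using (_≡_; refl; sym; subst)
open import Function.Bundles using (_⇔_; mk⇔; Equivalence)

fromWhen : {b : Bool} {A : Set} → b ≡ true → When b A → A
fromWhen refl x = x

IsBisimulation : {Δ : Signature} (O : Fragment) (𝔐 𝔑 : Model Δ) (ℓ : ℕ) → BRel 𝔐 𝔑 ℓ → Set
IsBisimulation O 𝔐 𝔑 ℓ B = ∀ w̄ w v̄ v → B w̄ w v̄ v → IsBisimAt O 𝔐 𝔑 ℓ B w̄ w v̄ v

module _ {Δ : Signature} {O : Fragment} {𝔐 𝔑 : Model Δ} {ℓ : ℕ} {B : BRel 𝔐 𝔑 ℓ}
         (isBisim : IsBisimulation O 𝔐 𝔑 ℓ B)
         {w̄ : Vec (Model.State 𝔐) ℓ} {v̄ : Vec (Model.State 𝔑) ℓ} where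

  private
    module M = Model 𝔐
    module N = Model 𝔑
    module At {w v} (b : B w̄ w v̄ v) = IsBisimAt (isBisim w̄ w v̄ v b)

  basic-⇔ : ∀ {w v} → B w̄ w v̄ v → ∀ φ → (𝔐 , w ⊨b φ) ⇔ (𝔑 , v ⊨b φ)
  basic-⇔ b (inj₁ k) = At.nomc b k
  basic-⇔ b (inj₂ p) = At.prop b p

  rel-variable-⇔ : Fragment.dia O ≡ true → ∀ {w v} → B w̄ w v̄ v →
                   ∀ a j → M.rel a w (lookup w̄ j) ⇔ N.rel a v (lookup v̄ j)
  rel-variable-⇔ dia b a j = mk⇔ forth back
    where
    forth : M.rel a _ (lookup w̄ j) → N.rel a _ (lookup v̄ j)
    forth r with fromWhen dia (At.forth b) a (lookup w̄ j) r
    ... | v' , r' , b' = subst (N.rel a _) (sym (Equivalence.to (At.wvar b' j) refl)) r'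
    back : N.rel a _ (lookup v̄ j) → M.rel a _ (lookup w̄ j)
    back r with fromWhen dia (At.back b) a (lookup v̄ j) r
    ... | w' , r' , b' = subst (M.rel a _) (sym (Equivalence.from (At.wvar b' j) refl)) r'

  module _ (at : Fragment.at O ≡ true) {w v} (b : B w̄ w v̄ v) where

    variables-related : ∀ i → B w̄ (lookup w̄ i) v̄ (lookup v̄ i)
    variables-related = fromWhen at (At.atv b)

    variables-≡-⇔ : ∀ i j → (lookup w̄ j ≡ lookup w̄ i) ⇔ (lookup v̄ j ≡ lookup v̄ i)
    variables-≡-⇔ i = At.wvar (variables-related i)

    variables-isPartialIso : Fragment.dia O ≡ true → IsPartialIso 𝔐 𝔑 w̄ v̄
    variables-isPartialIso dia = record
      { wellDefined = λ i j → Equivalence.to (variables-≡-⇔ j i)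
      ; injective   = λ i j → Equivalence.from (variables-≡-⇔ j i)
      ; basic       = λ i → basic-⇔ (variables-related i)
      ; relations   = λ a i j → rel-variable-⇔ dia (variables-related i) a j
      }

mainTheorem9 : {Δ : Signature} (O : Fragment) →
    Fragment.dia O ≡ true → Fragment.at O ≡ true → Fragment.store O ≡ true → Fragment.ex O ≡ false →
    (𝔐 𝔑 : Model Δ) (Bω : OmegaBisim O 𝔐 𝔑) (ℓ : ℕ)
    (w̄ : Vec (Model.State 𝔐) ℓ) (w : Model.State 𝔐) (v̄ : Vec (Model.State 𝔑) ℓ) (v : Model.State 𝔑) →
    OmegaBisim.B Bω ℓ w̄ w v̄ v →
    IsPartialIso 𝔐 𝔑 w̄ v̄
mainTheorem9 O dia at _ _ 𝔐 𝔑 Bω ℓ w̄ w v̄ v b =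
  variables-isPartialIso (OmegaBisim.bisim Bω ℓ) at b dia
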